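{- Let $i_1\ge i_2\ge 1$ be integers. Then $A(i_1+1)A(i_2-1)\ge A(i_1)A(i_2)$.
   Context: For $n\ge 1$, $A(n)$ denotes the number of monotone triangles of size $n$ (equivalently, the number of $n\times n$ alternating-sign matrices), $A(n)=\prod_{k=0}^{n-1}\frac{(3k+1)!}{(n+k)!}$; by convention $A(0)=1$. A monotone triangle of size $n$ is a triangular array of integers $(\tau(i,j))_{1\le j\le i\le n}$ with entries in $[n]$ such that $\tau(i,j)<\tau(i,j+1)$ and $\tau(i,j)\le\tau(i-1,j)\le\tau(i,j+1)$ for $1\le j<i$. -}

module Defs where

open import Data.Nat using (ℕ; zero; suc; _+_; _*_; _/_; NonZero; _!)
open import Data.Nat.Properties using (m*n≢0)
open import Data.Nat.Properties using (_!≢0)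

ASMnum : ℕ → ℕ
ASMnum zero    = 1
ASMnum (suc k) = ASMnum k * (3 * k + 1) !

ASMden : ℕ → ℕ → ℕ
ASMden zero    n = 1
ASMden (suc k) n = ASMden k n * (n + k) !

ASMden≢0 : ∀ m n → NonZero (ASMden m n)
ASMden≢0 zero    n = _
ASMden≢0 (suc k) n = m*n≢0 (ASMden k n) ((n + k) !) {{ASMden≢0 k n}} {{(n + k) !≢0}}

-- A n = ∏_{k=0}^{n-1} (3k+1)! / (n+k)!   (A 0 = 1 / 1 = 1).
-- The quotient is exact (A n is an integer), so ℕ division is faithful.
A : ℕ → ℕ
A n = (ASMnum n / ASMden n n) {{ASMden≢0 n n}}

{-# OPTIONS --safe #-}
-- Since A (n + 1) / A n = n! (3n+1)! / ((2n)! (2n+1)!), consecutive ratios differ by the factor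
-- (n+1)(3n+2)(3n+3)(3n+4) / ((2n+1)(2n+2)²(2n+3)) ≥ 1, so A (n + 1) / A n increases with n,
-- which is the inequality. As A is defined by truncating division, the substance is that
-- ∏_{k<n} (n+k)! divides ∏_{k<n} (3k+1)!. By Legendre's formula this is the inequality
-- Σ_{k<n} ⌊(n+k)/m⌋ ≤ Σ_{k<n} ⌊(3k+1)/m⌋ for all m ≥ 1, applied to the prime powers m = p^i.
module Submission where

open import Defs
open import Data.Nat
open import Data.Nat.Properties
open import Data.Nat.DivMod
open import Data.Nat.Divisibility
open import Data.Nat.Induction using (<-rec)
open import Data.Nat.Primality
  using (Prime; euclidsLemma; prime⇒nonZero; prime⇒nonTrivial; prime⇒irreducible; ¬prime[1])
open import Data.Nat.Primality.Factorisation using (factorise; module PrimeFactorisation)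
open import Data.Nat.ListAction using (product)
open import Data.Nat.Tactic.RingSolver
open import Data.List.Base using (_∷_)
open import Data.List.Relation.Unary.All using (All; []; _∷_)
open import Data.Product using (∃-syntax; ∃₂; _×_; _,_)
open import Data.Sum using (inj₁; inj₂)
open import Relation.Nullary using (Dec; yes; no; contradiction)
open import Relation.Binary.PropositionalEquality
open import Algebra.Properties.CommutativeSemigroup +-commutativeSemigroup
  using () renaming (interchange to +-interchange)
open import Algebra.Properties.CommutativeSemigroup *-commutativeSemigroup
  using (x∙yz≈y∙xz; x∙yz≈xz∙y) renaming (interchange to *-interchange)

𝟙 : {P : Set} → Dec P → ℕ
𝟙 (yes _) = 1
𝟙 (no _)  = 0

𝟙-cong : {P Q : Set} → (P → Q) → (Q → P) → (p : Dec P) (q : Dec Q) → 𝟙 p ≡ 𝟙 q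
𝟙-cong _   _   (yes _) (yes _) = refl
𝟙-cong _   _   (no _)  (no _)  = refl
𝟙-cong P⇒Q _   (yes p) (no ¬q) = contradiction (P⇒Q p) ¬q
𝟙-cong _   Q⇒P (no ¬p) (yes q) = contradiction (Q⇒P q) ¬p

∑ : ℕ → (ℕ → ℕ) → ℕ
∑ zero    f = 0
∑ (suc n) f = ∑ n f + f n

∏ : ℕ → (ℕ → ℕ) → ℕ
∏ zero    f = 1
∏ (suc n) f = ∏ n f * f n

infix 10 ∑ ∏
syntax ∑ n (λ k → e) = ∑[ k < n ] e
syntax ∏ n (λ k → e) = ∏[ k < n ] e

module _ {f g : ℕ → ℕ} where

  ∑-cong : ∀ n → (∀ {k} → k < n → f k ≡ g k) → ∑ n f ≡ ∑ n g
  ∑-cong zero    _  = refl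
  ∑-cong (suc n) eq = cong₂ _+_ (∑-cong n (λ k<n → eq (m≤n⇒m≤1+n k<n))) (eq ≤-refl)

  ∑-mono-≤ : ∀ n → (∀ {k} → k < n → f k ≤ g k) → ∑ n f ≤ ∑ n g
  ∑-mono-≤ zero    _  = z≤n
  ∑-mono-≤ (suc n) le = +-mono-≤ (∑-mono-≤ n (λ k<n → le (m≤n⇒m≤1+n k<n))) (le ≤-refl)

∑-distrib-+ : ∀ n f g → ∑[ k < n ] (f k + g k) ≡ ∑ n f + ∑ n g
∑-distrib-+ zero    f g = refl
∑-distrib-+ (suc n) f g = begin
  ∑[ k < n ] (f k + g k) + (f n + g n) ≡⟨ cong (_+ (f n + g n)) (∑-distrib-+ n f g) ⟩
  ∑ n f + ∑ n g + (f n + g n)          ≡⟨ +-interchange (∑ n f) (∑ n g) (f n) (g n) ⟩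
  ∑ n f + f n + (∑ n g + g n)          ∎
  where open ≡-Reasoning

∑-const : ∀ n c → ∑[ k < n ] c ≡ n * c
∑-const zero    c = refl
∑-const (suc n) c = trans (cong (_+ c) (∑-const n c)) (+-comm (n * c) c)

∑-split : ∀ a n f → ∑ (a + n) f ≡ ∑ a f + ∑[ k < n ] f (a + k)
∑-split a zero    f = trans (cong (λ b → ∑ b f) (+-identityʳ a)) (sym (+-identityʳ _))
∑-split a (suc n) f = begin
  ∑ (a + suc n) f                              ≡⟨ cong (λ b → ∑ b f) (+-suc a n) ⟩
  ∑ (a + n) f + f (a + n)                      ≡⟨ cong (_+ f (a + n)) (∑-split a n f) ⟩
  ∑ a f + ∑[ k < n ] f (a + k) + f (a + n)     ≡⟨ +-assoc (∑ a f) _ _ ⟩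
  ∑ a f + ∑[ k < suc n ] f (a + k)             ∎
  where open ≡-Reasoning

∑-pairs : ∀ n f → ∑ (n + n) f ≡ ∑[ k < n ] (f (k + k) + f (suc (k + k)))
∑-pairs zero    f = refl
∑-pairs (suc n) f = begin
  ∑ (suc n + suc n) f                                   ≡⟨ cong (λ b → ∑ (suc b) f) (+-suc n n) ⟩
  ∑ (n + n) f + f (n + n) + f (suc (n + n))              ≡⟨ +-assoc (∑ (n + n) f) _ _ ⟩
  ∑ (n + n) f + (f (n + n) + f (suc (n + n)))            ≡⟨ cong (_+ (f (n + n) + f (suc (n + n)))) (∑-pairs n f) ⟩
  ∑[ k < suc n ] (f (k + k) + f (suc (k + k)))          ∎
  where open ≡-Reasoning

∑-comm : ∀ n b (F : ℕ → ℕ → ℕ) → ∑[ k < n ] ∑ b (F k) ≡ ∑[ i < b ] ∑[ k < n ] F k i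
∑-comm zero    b F = sym (trans (∑-const b 0) (*-zeroʳ b))
∑-comm (suc n) b F = begin
  ∑[ k < n ] ∑ b (F k) + ∑ b (F n)                   ≡⟨ cong (_+ ∑ b (F n)) (∑-comm n b F) ⟩
  ∑[ i < b ] ∑[ k < n ] F k i + ∑ b (F n)           ≡⟨ ∑-distrib-+ b _ (F n) ⟨
  ∑[ i < b ] ∑[ k < suc n ] F k i                   ∎
  where open ≡-Reasoning

∑-[≤] : ∀ c N → ∑[ j < N ] 𝟙 (c ≤? j) ≡ N ∸ c
∑-[≤] c zero    = sym (0∸n≡0 c)
∑-[≤] c (suc N) with c ≤? N
... | yes c≤N = begin
  ∑[ j < N ] 𝟙 (c ≤? j) + 1   ≡⟨ cong (_+ 1) (∑-[≤] c N) ⟩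
  N ∸ c + 1                   ≡⟨ +-comm (N ∸ c) 1 ⟩
  suc (N ∸ c)                 ≡⟨ +-∸-assoc 1 c≤N ⟨
  suc N ∸ c                   ∎
  where open ≡-Reasoning
... | no  c≰N = begin
  ∑[ j < N ] 𝟙 (c ≤? j) + 0   ≡⟨ +-identityʳ _ ⟩
  ∑[ j < N ] 𝟙 (c ≤? j)       ≡⟨ ∑-[≤] c N ⟩
  N ∸ c                       ≡⟨ m≤n⇒m∸n≡0 (<⇒≤ N<c) ⟩
  0                           ≡⟨ m≤n⇒m∸n≡0 N<c ⟨
  suc N ∸ c                   ∎
  where
  open ≡-Reasoning
  N<c : N < c
  N<c = ≰⇒> c≰N

∑-[<] : ∀ c B → ∑[ i < B ] 𝟙 (i <? c) ≡ B ⊓ c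
∑-[<] c zero    = refl
∑-[<] c (suc B) with B <? c
... | yes B<c = begin
  ∑[ i < B ] 𝟙 (i <? c) + 1   ≡⟨ cong (_+ 1) (∑-[<] c B) ⟩
  B ⊓ c + 1                   ≡⟨ cong (_+ 1) (m≤n⇒m⊓n≡m (<⇒≤ B<c)) ⟩
  B + 1                       ≡⟨ +-comm B 1 ⟩
  suc B                       ≡⟨ m≤n⇒m⊓n≡m B<c ⟨
  suc B ⊓ c                   ∎
  where open ≡-Reasoning
... | no  B≮c = begin
  ∑[ i < B ] 𝟙 (i <? c) + 0   ≡⟨ +-identityʳ _ ⟩
  ∑[ i < B ] 𝟙 (i <? c)       ≡⟨ ∑-[<] c B ⟩
  B ⊓ c                       ≡⟨ m≥n⇒m⊓n≡n c≤B ⟩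
  c                           ≡⟨ m≥n⇒m⊓n≡n (m≤n⇒m≤1+n c≤B) ⟨
  suc B ⊓ c                   ∎
  where
  open ≡-Reasoning
  c≤B : c ≤ B
  c≤B = ≮⇒≥ B≮c

∑-periodic : ∀ m n f {c} → (∀ k → f (m + k) ≡ f k + c) → ∑ (m + n) f ≡ ∑ m f + (∑ n f + n * c)
∑-periodic m n f {c} periodic = begin
  ∑ (m + n) f                          ≡⟨ ∑-split m n f ⟩
  ∑ m f + ∑[ k < n ] f (m + k)         ≡⟨ cong (∑ m f +_) (∑-cong n (λ {k} _ → periodic k)) ⟩
  ∑ m f + ∑[ k < n ] (f k + c)         ≡⟨ cong (∑ m f +_) (∑-distrib-+ n f (λ _ → c)) ⟩
  ∑ m f + (∑ n f + ∑[ k < n ] c)       ≡⟨ cong (λ s → ∑ m f + (∑ n f + s)) (∑-const n c) ⟩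
  ∑ m f + (∑ n f + n * c)              ∎
  where open ≡-Reasoning

∑-mono-≤-periodic : ∀ m .{{_ : NonZero m}} {f g c} →
                    (∀ k → f (m + k) ≡ f k + c) → (∀ k → g (m + k) ≡ g k + c) →
                    (∀ {n} → n ≤ m → ∑ n f ≤ ∑ n g) → ∀ n → ∑ n f ≤ ∑ n g
∑-mono-≤-periodic m {f} {g} {c} f-periodic g-periodic initial = <-rec _ step
  where
  step : ∀ n → (∀ {r} → r < n → ∑ r f ≤ ∑ r g) → ∑ n f ≤ ∑ n g
  step n below with n ≤? m
  ... | yes n≤m = initial n≤m
  ... | no  n≰m = subst (λ n → ∑ n f ≤ ∑ n g) (m+[n∸m]≡n m≤n) (begin
    ∑ (m + r) f              ≡⟨ ∑-periodic m r f f-periodic ⟩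
    ∑ m f + (∑ r f + r * c)  ≤⟨ +-mono-≤ (initial ≤-refl) (+-monoˡ-≤ (r * c) (below r<n)) ⟩
    ∑ m g + (∑ r g + r * c)  ≡⟨ ∑-periodic m r g g-periodic ⟨
    ∑ (m + r) g              ∎)
    where
    open ≤-Reasoning
    r : ℕ
    r = n ∸ m
    m≤n : m ≤ n
    m≤n = <⇒≤ (≰⇒> n≰m)
    r<n : r < n
    r<n = ∸-monoʳ-< (>-nonZero⁻¹ m) m≤n

[m+n]∸[o+p]≤[m∸o]+[n∸p] : ∀ m n o p → (m + n) ∸ (o + p) ≤ (m ∸ o) + (n ∸ p)
[m+n]∸[o+p]≤[m∸o]+[n∸p] m n o p = m≤n+o⇒m∸n≤o (m + n) (o + p) (begin
  m + n                        ≤⟨ +-mono-≤ (m≤n+m∸n m o) (m≤n+m∸n n p) ⟩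
  o + (m ∸ o) + (p + (n ∸ p))  ≡⟨ +-interchange o (m ∸ o) p (n ∸ p) ⟩
  o + p + ((m ∸ o) + (n ∸ p))  ∎)
  where open ≤-Reasoning

thirds : ∀ m → ∃₂ λ c₁ c₂ → c₁ + c₂ ≡ m × m ≤ 3 * c₁ + 1 × 2 * m ≤ 3 * c₂ + 1
thirds 0 = 0 , 0 , refl , z≤n , z≤n
thirds 1 = 0 , 1 , refl , ≤-refl , s≤s (s≤s z≤n)
thirds 2 = 1 , 1 , refl , s≤s (s≤s z≤n) , ≤-refl
thirds (suc (suc (suc m))) with thirds m
... | c₁ , c₂ , refl , m≤3c₁+1 , 2m≤3c₂+1 =
  suc c₁ , suc (suc c₂) , sum-eq c₁ c₂ ,
  subst (3 + m ≤_) (eq₁ c₁) (+-monoʳ-≤ 3 m≤3c₁+1) ,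
  subst₂ _≤_ (eq₂ m) (eq₃ c₂) (+-monoʳ-≤ 6 2m≤3c₂+1)
  where
  sum-eq : ∀ a b → suc a + suc (suc b) ≡ 3 + (a + b)
  sum-eq = solve-∀
  eq₁ : ∀ c → 3 + (3 * c + 1) ≡ 3 * suc c + 1
  eq₁ = solve-∀
  eq₂ : ∀ m → 6 + 2 * m ≡ 2 * (3 + m)
  eq₂ = solve-∀
  eq₃ : ∀ c → 6 + (3 * c + 1) ≡ 3 * (2 + c) + 1
  eq₃ = solve-∀

module _ (m : ℕ) .{{_ : NonZero m}} where

  [x+km]/m≡x/m+k : ∀ x k → (x + k * m) / m ≡ x / m + k
  [x+km]/m≡x/m+k x k = trans (+-distrib-/-∣ʳ x (n∣m*n k)) (cong (x / m +_) (m*n/n≡m k m))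

  *≤⇒≤/ : ∀ {t x} → t * m ≤ x → t ≤ x / m
  *≤⇒≤/ {t} tm≤x = subst (_≤ _) (m*n/n≡m t m) (/-monoˡ-≤ m tm≤x)

  /≤𝟙 : ∀ {j} → j < 2 * m → j / m ≤ 𝟙 (m ≤? j)
  /≤𝟙 {j} j<2m with m ≤? j
  ... | yes _   = s≤s⁻¹ (m<n*o⇒m/o<n j<2m)
  ... | no  m≰j = ≤-reflexive (m<n⇒m/n≡0 (≰⇒> m≰j))

  ≤[3k+1]/ : ∀ {t c k} → t * m ≤ 3 * c + 1 → c ≤ k → t ≤ (3 * k + 1) / m
  ≤[3k+1]/ tm≤3c+1 c≤k = *≤⇒≤/ (≤-trans tm≤3c+1 (+-monoˡ-≤ 1 (*-monoʳ-≤ 3 c≤k)))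

  𝟙+𝟙≤/ : ∀ {c₁ c₂} → m ≤ 3 * c₁ + 1 → 2 * m ≤ 3 * c₂ + 1 →
          ∀ k → 𝟙 (c₁ ≤? k) + 𝟙 (c₂ ≤? k) ≤ (3 * k + 1) / m
  𝟙+𝟙≤/ {c₁} {c₂} m≤3c₁+1 2m≤3c₂+1 k with c₁ ≤? k | c₂ ≤? k
  ... | yes c₁≤k | yes c₂≤k = ≤[3k+1]/ 2m≤3c₂+1 c₂≤k
  ... | yes c₁≤k | no  _    = ≤[3k+1]/ (≤-trans (≤-reflexive (*-identityˡ m)) m≤3c₁+1) c₁≤k
  ... | no  _    | yes c₂≤k = ≤[3k+1]/ {t = 1} (≤-trans (*-monoˡ-≤ m {1} {2} (s≤s z≤n)) 2m≤3c₂+1) c₂≤k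
  ... | no  _    | no  _    = z≤n

  -- Adding ∑ ⌊k/m⌋ to both sides of floor-sum-≤ turns its left side into ∑_{j<2n} ⌊j/m⌋.
  -- Grouped as below, both summands grow by exactly 4 when k grows by m, so it suffices
  -- to compare partial sums of length n ≤ m, where the left side is just 2n ∸ m.
  private
    doubled tripled : ℕ → ℕ
    doubled k = (k + k) / m + suc (k + k) / m
    tripled k = (3 * k + 1) / m + k / m

    doubled-periodic : ∀ k → doubled (m + k) ≡ doubled k + 4
    doubled-periodic k = begin
      ((m + k) + (m + k)) / m + suc ((m + k) + (m + k)) / m
        ≡⟨ cong₂ (λ a b → a / m + b / m) (eq m k) (cong suc (eq m k)) ⟩
      ((k + k) + 2 * m) / m + (suc (k + k) + 2 * m) / m
        ≡⟨ cong₂ _+_ ([x+km]/m≡x/m+k (k + k) 2) ([x+km]/m≡x/m+k (suc (k + k)) 2) ⟩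
      ((k + k) / m + 2) + (suc (k + k) / m + 2)
        ≡⟨ +-interchange ((k + k) / m) 2 (suc (k + k) / m) 2 ⟩
      doubled k + 4 ∎
      where
      open ≡-Reasoning
      eq : ∀ m k → (m + k) + (m + k) ≡ (k + k) + 2 * m
      eq = solve-∀

    tripled-periodic : ∀ k → tripled (m + k) ≡ tripled k + 4
    tripled-periodic k = begin
      (3 * (m + k) + 1) / m + (m + k) / m
        ≡⟨ cong₂ (λ a b → a / m + b / m) (eq₁ m k) (eq₂ m k) ⟩
      ((3 * k + 1) + 3 * m) / m + (k + 1 * m) / m
        ≡⟨ cong₂ _+_ ([x+km]/m≡x/m+k (3 * k + 1) 3) ([x+km]/m≡x/m+k k 1) ⟩
      ((3 * k + 1) / m + 3) + (k / m + 1)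
        ≡⟨ +-interchange ((3 * k + 1) / m) 3 (k / m) 1 ⟩
      tripled k + 4 ∎
      where
      open ≡-Reasoning
      eq₁ : ∀ m k → 3 * (m + k) + 1 ≡ (3 * k + 1) + 3 * m
      eq₁ = solve-∀
      eq₂ : ∀ m k → m + k ≡ k + 1 * m
      eq₂ = solve-∀

    ∑doubled≤∑tripled-initial : ∀ {n} → n ≤ m → ∑ n doubled ≤ ∑ n tripled
    ∑doubled≤∑tripled-initial {n} n≤m with thirds m
    ... | c₁ , c₂ , c₁+c₂≡m , m≤3c₁+1 , 2m≤3c₂+1 = begin
      ∑ n doubled
        ≡⟨ ∑-pairs n (_/ m) ⟨
      ∑[ j < n + n ] (j / m)
        ≤⟨ ∑-mono-≤ (n + n) (λ j<2n → /≤𝟙 (<-≤-trans j<2n 2n≤2m)) ⟩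
      ∑[ j < n + n ] 𝟙 (m ≤? j)
        ≡⟨ ∑-[≤] m (n + n) ⟩
      (n + n) ∸ m
        ≡⟨ cong ((n + n) ∸_) c₁+c₂≡m ⟨
      (n + n) ∸ (c₁ + c₂)
        ≤⟨ [m+n]∸[o+p]≤[m∸o]+[n∸p] n n c₁ c₂ ⟩
      (n ∸ c₁) + (n ∸ c₂)
        ≡⟨ cong₂ _+_ (∑-[≤] c₁ n) (∑-[≤] c₂ n) ⟨
      ∑[ k < n ] 𝟙 (c₁ ≤? k) + ∑[ k < n ] 𝟙 (c₂ ≤? k)
        ≡⟨ ∑-distrib-+ n _ _ ⟨
      ∑[ k < n ] (𝟙 (c₁ ≤? k) + 𝟙 (c₂ ≤? k))
        ≤⟨ ∑-mono-≤ n (λ {k} _ → 𝟙+𝟙≤/ {c₁} {c₂} m≤3c₁+1 2m≤3c₂+1 k) ⟩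
      ∑[ k < n ] ((3 * k + 1) / m)
        ≤⟨ ∑-mono-≤ n (λ _ → m≤m+n _ _) ⟩
      ∑ n tripled
        ∎
      where
      open ≤-Reasoning
      2n≤2m : n + n ≤ 2 * m
      2n≤2m = ≤-trans (+-mono-≤ n≤m n≤m) (≤-reflexive (cong (m +_) (sym (+-identityʳ m))))

  floor-sum-≤ : ∀ n → ∑[ k < n ] ((n + k) / m) ≤ ∑[ k < n ] ((3 * k + 1) / m)
  floor-sum-≤ n = +-cancelʳ-≤ (∑ n (_/ m)) _ _ (begin
    ∑[ k < n ] ((n + k) / m) + ∑ n (_/ m)            ≡⟨ +-comm _ (∑ n (_/ m)) ⟩
    ∑ n (_/ m) + ∑[ k < n ] ((n + k) / m)            ≡⟨ ∑-split n n (_/ m) ⟨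
    ∑ (n + n) (_/ m)                                 ≡⟨ ∑-pairs n (_/ m) ⟩
    ∑ n doubled
      ≤⟨ ∑-mono-≤-periodic m doubled-periodic tripled-periodic ∑doubled≤∑tripled-initial n ⟩
    ∑ n tripled                                      ≡⟨ ∑-distrib-+ n _ _ ⟩
    ∑[ k < n ] ((3 * k + 1) / m) + ∑ n (_/ m)        ∎)
    where open ≤-Reasoning

m^n∣m^o : ∀ m {n o} → n ≤ o → m ^ n ∣ m ^ o
m^n∣m^o m {n} {o} n≤o = divides (m ^ (o ∸ n)) (begin
  m ^ o             ≡⟨ cong (m ^_) (m∸n+n≡m n≤o) ⟨
  m ^ (o ∸ n + n)   ≡⟨ ^-distribˡ-+-* m (o ∸ n) n ⟩
  m ^ (o ∸ n) * m ^ n ∎)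
  where open ≡-Reasoning

/-suc : ∀ q .{{_ : NonZero q}} x → suc x / q ≡ x / q + 𝟙 (q ∣? suc x)
/-suc q x with q ∣? suc x
... | yes q∣1+x = begin
  suc x / q                  ≡⟨ /-congˡ 1+x≡[1+x/q]q ⟩
  suc (x / q) * q / q        ≡⟨ m*n/n≡m (suc (x / q)) q ⟩
  suc (x / q)                ≡⟨ +-comm 1 (x / q) ⟩
  x / q + 1                  ∎
  where
  open ≡-Reasoning
  1+x≡[1+x/q]q : suc x ≡ suc (x / q) * q
  1+x≡[1+x/q]q = begin
    suc x                      ≡⟨ cong suc (m≡m%n+[m/n]*n x q) ⟩
    suc (x % q) + x / q * q    ≡⟨ cong (λ r → suc r + x / q * q) (%-pred-≡0 (n∣m⇒m%n≡0 (suc x) q q∣1+x)) ⟩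
    suc (q ∸ 1) + x / q * q    ≡⟨ cong (_+ x / q * q) (suc-pred q) ⟩
    suc (x / q) * q            ∎
... | no  q∤1+x = begin
  suc x / q                     ≡⟨ /-congˡ (cong suc (m≡m%n+[m/n]*n x q)) ⟩
  (suc (x % q) + x / q * q) / q ≡⟨ +-distrib-/-∣ʳ (suc (x % q)) (n∣m*n (x / q)) ⟩
  suc (x % q) / q + x / q * q / q ≡⟨ cong₂ _+_ (m<n⇒m/n≡0 1+x%q<q) (m*n/n≡m (x / q) q) ⟩
  x / q                         ≡⟨ +-identityʳ (x / q) ⟨
  x / q + 0                     ∎
  where
  open ≡-Reasoning
  1+x%q<q : suc (x % q) < q
  1+x%q<q = ≤∧≢⇒< (m%n<n x q) λ 1+x%q≡q → q∤1+x (divides (suc (x / q)) (begin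
    suc x                      ≡⟨ cong suc (m≡m%n+[m/n]*n x q) ⟩
    suc (x % q) + x / q * q    ≡⟨ cong (_+ x / q * q) 1+x%q≡q ⟩
    suc (x / q) * q            ∎))

infix 4 _^_∥_
record _^_∥_ (p e x : ℕ) : Set where
  constructor ∥-intro
  field
    cofactor     : ℕ
    ≡^*cofactor  : x ≡ p ^ e * cofactor
    ∤cofactor    : p ∤ cofactor

module _ {p : ℕ} (p-prime : Prime p) where

  private instance
    p≢0 : NonZero p
    p≢0 = prime⇒nonZero p-prime

  1<p : 1 < p
  1<p = nonTrivial⇒n>1 p {{prime⇒nonTrivial p-prime}}

  n<p^n : ∀ n → n < p ^ n
  n<p^n zero    = z<s
  n<p^n (suc n) = begin-strict
    suc n      ≤⟨ n<p^n n ⟩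
    p ^ n      <⟨ m<m*n (p ^ n) p {{m^n≢0 p n}} 1<p ⟩
    p ^ n * p  ≡⟨ *-comm (p ^ n) p ⟩
    p ^ suc n  ∎
    where open ≤-Reasoning

  p∤1 : p ∤ 1
  p∤1 p∣1 = <-irrefl (sym (∣1⇒≡1 p∣1)) 1<p

  ∤-* : ∀ {w u} → p ∤ w → p ∤ u → p ∤ w * u
  ∤-* {w} {u} p∤w p∤u p∣wu with euclidsLemma w u p-prime p∣wu
  ... | inj₁ p∣w = p∤w p∣w
  ... | inj₂ p∣u = p∤u p∣u

  ∥-1 : p ^ 0 ∥ 1
  ∥-1 = ∥-intro 1 refl p∤1

  ∥-* : ∀ {a b x y} → p ^ a ∥ x → p ^ b ∥ y → p ^ (a + b) ∥ x * y
  ∥-* {a} {b} (∥-intro w refl p∤w) (∥-intro u refl p∤u) = ∥-intro (w * u) eq (∤-* p∤w p∤u)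
    where
    eq : p ^ a * w * (p ^ b * u) ≡ p ^ (a + b) * (w * u)
    eq = trans (*-interchange (p ^ a) w (p ^ b) u) (cong (_* (w * u)) (sym (^-distribˡ-+-* p a b)))

  ^∣^*⇒≤ : ∀ {w} → p ∤ w → ∀ d e → p ^ d ∣ p ^ e * w → d ≤ e
  ^∣^*⇒≤ p∤w zero    e       _ = z≤n
  ^∣^*⇒≤ {w} p∤w (suc d) zero    p^1+d∣w =
    contradiction (m*n∣⇒m∣ p (p ^ d) (subst (p ^ suc d ∣_) (*-identityˡ w) p^1+d∣w)) p∤w
  ^∣^*⇒≤ {w} p∤w (suc d) (suc e) p^1+d∣p^1+e*w =
    s≤s (^∣^*⇒≤ p∤w d e (*-cancelˡ-∣ p (subst (p ^ suc d ∣_) (*-assoc p (p ^ e) w) p^1+d∣p^1+e*w)))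

  ∥⇒^∣⇒≤ : ∀ {d e x} → p ^ e ∥ x → p ^ d ∣ x → d ≤ e
  ∥⇒^∣⇒≤ {d} {e} (∥-intro w refl p∤w) = ^∣^*⇒≤ p∤w d e

  ≤⇒^∣ : ∀ {d e x} → p ^ e ∥ x → d ≤ e → p ^ d ∣ x
  ≤⇒^∣ (∥-intro w refl _) d≤e = ∣m⇒∣m*n w (m^n∣m^o p d≤e)

  ∥⇒< : ∀ {e x} → .{{NonZero x}} → p ^ e ∥ x → e < x
  ∥⇒< {e} {x} p^e∥x = <-≤-trans (n<p^n e) (∣⇒≤ (≤⇒^∣ {d = e} p^e∥x ≤-refl))

  ∥-exists : ∀ x → .{{NonZero x}} → ∃[ e ] p ^ e ∥ x
  ∥-exists = <-rec (λ x → .{{NonZero x}} → ∃[ e ] p ^ e ∥ x) step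
    where
    step : ∀ x → (∀ {y} → y < x → .{{NonZero y}} → ∃[ e ] p ^ e ∥ y) → .{{NonZero x}} → ∃[ e ] p ^ e ∥ x
    step x below with p ∣? x
    ... | no  p∤x = 0 , ∥-intro x (sym (*-identityˡ x)) p∤x
    ... | yes (divides y refl) with below (m<m*n y p {{y≢0}} 1<p) {{y≢0}}
      where
      y≢0 : NonZero y
      y≢0 = m*n≢0⇒m≢0 y
    ...   | e , ∥-intro w refl p∤w = suc e , ∥-intro w eq p∤w
      where
      eq : p ^ e * w * p ≡ p * p ^ e * w
      eq = trans (*-comm _ p) (sym (*-assoc p (p ^ e) w))

  ⌊_/p^[1+_]⌋ : ℕ → ℕ → ℕ
  ⌊ x /p^[1+ i ]⌋ = (x / p ^ suc i) {{m^n≢0 p (suc i)}}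

  legendreSum : ℕ → ℕ → ℕ
  legendreSum B x = ∑[ i < B ] ⌊ x /p^[1+ i ]⌋

  legendreSum-suc : ∀ {B c x} → p ^ c ∥ suc x → c ≤ B → legendreSum B (suc x) ≡ c + legendreSum B x
  legendreSum-suc {B} {c} {x} p^c∥1+x c≤B = begin
    legendreSum B (suc x)
      ≡⟨ ∑-cong B (λ {i} _ → /-suc (p ^ suc i) {{m^n≢0 p (suc i)}} x) ⟩
    ∑[ i < B ] (⌊ x /p^[1+ i ]⌋ + 𝟙 (p ^ suc i ∣? suc x))
      ≡⟨ ∑-distrib-+ B ⌊ x /p^[1+_]⌋ (λ i → 𝟙 (p ^ suc i ∣? suc x)) ⟩
    legendreSum B x + ∑[ i < B ] 𝟙 (p ^ suc i ∣? suc x)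
      ≡⟨ cong (legendreSum B x +_) (∑-cong B (λ {i} _ → 𝟙-cong (∥⇒^∣⇒≤ p^c∥1+x) (≤⇒^∣ p^c∥1+x) _ _)) ⟩
    legendreSum B x + ∑[ i < B ] 𝟙 (i <? c)
      ≡⟨ cong (legendreSum B x +_) (trans (∑-[<] c B) (m≥n⇒m⊓n≡n c≤B)) ⟩
    legendreSum B x + c
      ≡⟨ +-comm (legendreSum B x) c ⟩
    c + legendreSum B x
      ∎
    where open ≡-Reasoning

  legendre : ∀ {B} x → x ≤ B → p ^ legendreSum B x ∥ x !
  legendre {B} zero    _ = subst (λ e → p ^ e ∥ 1) (sym legendreSum-0) ∥-1
    where
    legendreSum-0 : legendreSum B 0 ≡ 0
    legendreSum-0 = trans (∑-cong B (λ {i} _ → 0/n≡0 (p ^ suc i) {{m^n≢0 p (suc i)}})) (trans (∑-const B 0) (*-zeroʳ B))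
  legendre {B} (suc x) 1+x≤B with ∥-exists (suc x)
  ... | c , p^c∥1+x = subst (λ e → p ^ e ∥ suc x !) (sym (legendreSum-suc p^c∥1+x c≤B))
                        (∥-* p^c∥1+x (legendre x (<⇒≤ 1+x≤B)))
    where
    c≤B : c ≤ B
    c≤B = <⇒≤ (<-≤-trans (∥⇒< p^c∥1+x) 1+x≤B)

  ∏!-∥ : ∀ {B} n (f : ℕ → ℕ) → (∀ {k} → k < n → f k ≤ B) →
         p ^ (∑[ k < n ] legendreSum B (f k)) ∥ ∏[ k < n ] (f k !)
  ∏!-∥ zero    f _   = ∥-1
  ∏!-∥ (suc n) f f≤B = ∥-* (∏!-∥ n f (λ k<n → f≤B (m≤n⇒m≤1+n k<n))) (legendre (f n) (f≤B ≤-refl))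

  ∑legendreSum-mono : ∀ B n → ∑[ k < n ] legendreSum B (n + k) ≤ ∑[ k < n ] legendreSum B (3 * k + 1)
  ∑legendreSum-mono B n = subst₂ _≤_
    (sym (∑-comm n B (λ k i → ⌊ n + k /p^[1+ i ]⌋)))
    (sym (∑-comm n B (λ k i → ⌊ 3 * k + 1 /p^[1+ i ]⌋)))
    (∑-mono-≤ B (λ {i} _ → floor-sum-≤ (p ^ suc i) {{m^n≢0 p (suc i)}} n))

prime^-divisor : ∀ {q n o} e → Prime q → q ∤ n → q ^ e ∣ n * o → q ^ e ∣ o
prime^-divisor {o = o} zero _ _ _ = 1∣ o
prime^-divisor {q} {n} {o} (suc e) q-prime q∤n q^1+e∣no
  with euclidsLemma n o q-prime (∣-trans (m∣m*n (q ^ e)) q^1+e∣no)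
... | inj₁ q∣n             = contradiction q∣n q∤n
... | inj₂ (divides o′ refl) =
  subst (q ^ suc e ∣_) (*-comm q o′) (*-monoʳ-∣ q (prime^-divisor e q-prime q∤n q^e∣no′))
  where
  instance
    q≢0 : NonZero q
    q≢0 = prime⇒nonZero q-prime
  rearrange : ∀ n o′ q → n * (o′ * q) ≡ q * (n * o′)
  rearrange = solve-∀
  q^e∣no′ : q ^ e ∣ n * o′
  q^e∣no′ = *-cancelˡ-∣ q (subst (q ^ suc e ∣_) (rearrange n o′ q) q^1+e∣no)

prime≢⇒∤ : ∀ {p q} → Prime p → Prime q → q ≢ p → q ∤ p
prime≢⇒∤ p-prime q-prime q≢p q∣p with prime⇒irreducible p-prime q∣p
... | inj₁ refl = ¬prime[1] q-prime
... | inj₂ q≡p  = q≢p q≡p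

infix 4 _∣ᵖ_
_∣ᵖ_ : ℕ → ℕ → Set
b ∣ᵖ a = ∀ e {q} → Prime q → q ^ e ∣ b → q ^ e ∣ a

∏primes-∣ : ∀ {ps} → All Prime ps → ∀ {a} → product ps ∣ᵖ a → product ps ∣ a
∏primes-∣ []                     {a} _        = 1∣ a
∏primes-∣ {p ∷ ps} (p-prime ∷ ps-prime) {a} ∏∣ᵖa with p∣a
  where
  p∣a : p ∣ a
  p∣a = subst (_∣ a) (*-identityʳ p) (∏∣ᵖa 1 p-prime (*-monoʳ-∣ p (1∣ product ps)))
... | divides a′ refl = subst (p * product ps ∣_) (*-comm p a′) (*-monoʳ-∣ p (∏primes-∣ ps-prime ps∣ᵖa′))
  where
  instance
    p≢0 : NonZero p
    p≢0 = prime⇒nonZero p-prime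
  ps∣ᵖa′ : product ps ∣ᵖ a′
  ps∣ᵖa′ e {q} q-prime q^e∣ps with q ≟ p
  ... | yes refl = *-cancelˡ-∣ p
                     (subst (p ^ suc e ∣_) (*-comm a′ p) (∏∣ᵖa (suc e) p-prime (*-monoʳ-∣ p q^e∣ps)))
  ... | no  q≢p  = prime^-divisor e q-prime (prime≢⇒∤ p-prime q-prime q≢p)
                     (subst (q ^ e ∣_) (*-comm a′ p) (∏∣ᵖa e q-prime (∣-trans q^e∣ps (n∣m*n p))))

∣ᵖ⇒∣ : ∀ {b a} → .{{NonZero b}} → b ∣ᵖ a → b ∣ a
∣ᵖ⇒∣ {b} {a} b∣ᵖa = subst (_∣ a) (sym isFactorisation)
  (∏primes-∣ factorsPrime (λ e q-prime q^e∣∏ → b∣ᵖa e q-prime (subst (_ ∣_) (sym isFactorisation) q^e∣∏)))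
  where open PrimeFactorisation (factorise b)

ASMnum≡∏ : ∀ n → ASMnum n ≡ ∏[ k < n ] ((3 * k + 1) !)
ASMnum≡∏ zero    = refl
ASMnum≡∏ (suc n) = cong (_* (3 * n + 1) !) (ASMnum≡∏ n)

ASMden≡∏ : ∀ k n → ASMden k n ≡ ∏[ j < k ] ((n + j) !)
ASMden≡∏ zero    n = refl
ASMden≡∏ (suc k) n = cong (_* (n + k) !) (ASMden≡∏ k n)

ASMden∣ASMnum : ∀ n → ASMden n n ∣ ASMnum n
ASMden∣ASMnum n = ∣ᵖ⇒∣ {{ASMden≢0 n n}} den∣ᵖnum
  where
  B : ℕ
  B = 3 * n
  n+k≤B : ∀ {k} → k < n → n + k ≤ B
  n+k≤B k<n = +-monoʳ-≤ n (≤-trans (<⇒≤ k<n) (m≤m+n n (n + 0)))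
  3k+1≤B : ∀ {k} → k < n → 3 * k + 1 ≤ B
  3k+1≤B {k} k<n = ≤-trans (m≤m+n (3 * k + 1) 2) (≤-trans (≤-reflexive (eq k)) (*-monoʳ-≤ 3 k<n))
    where
    eq : ∀ k → 3 * k + 1 + 2 ≡ 3 * suc k
    eq = solve-∀
  den∣ᵖnum : ASMden n n ∣ᵖ ASMnum n
  den∣ᵖnum e {p} p-prime p^e∣den =
    ≤⇒^∣ p-prime {d = e} num-∥ (≤-trans (∥⇒^∣⇒≤ p-prime den-∥ p^e∣den) (∑legendreSum-mono p-prime B n))
    where
    νden νnum : ℕ
    νden = ∑[ k < n ] legendreSum p-prime B (n + k)
    νnum = ∑[ k < n ] legendreSum p-prime B (3 * k + 1)
    den-∥ : p ^ νden ∥ ASMden n n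
    den-∥ = subst (p ^ νden ∥_) (sym (ASMden≡∏ n n)) (∏!-∥ p-prime n (n +_) n+k≤B)
    num-∥ : p ^ νnum ∥ ASMnum n
    num-∥ = subst (p ^ νnum ∥_) (sym (ASMnum≡∏ n)) (∏!-∥ p-prime n (λ k → 3 * k + 1) 3k+1≤B)

ratio-mono : (P Q : ℕ → ℕ) → (∀ n → NonZero (P n)) → (∀ n → P n * Q (suc n) ≤ P (suc n) * Q n) →
             ∀ {c} a → c ≤ a → P c * Q a ≤ P a * Q c
ratio-mono P Q P≢0 step zero    z≤n   = ≤-refl
ratio-mono P Q P≢0 step {c} (suc a) c≤1+a with m≤n⇒m<n∨m≡n c≤1+a
... | inj₂ refl      = ≤-refl
... | inj₁ (s≤s c≤a) = *-cancelˡ-≤ (P a) {{P≢0 a}} (begin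
  P a * (P c * Q (suc a))      ≡⟨ x∙yz≈y∙xz (P a) (P c) (Q (suc a)) ⟩
  P c * (P a * Q (suc a))      ≤⟨ *-monoʳ-≤ (P c) (step a) ⟩
  P c * (P (suc a) * Q a)      ≡⟨ x∙yz≈y∙xz (P c) (P (suc a)) (Q a) ⟩
  P (suc a) * (P c * Q a)      ≤⟨ *-monoʳ-≤ (P (suc a)) (ratio-mono P Q P≢0 step a c≤a) ⟩
  P (suc a) * (P a * Q c)      ≡⟨ x∙yz≈y∙xz (P (suc a)) (P a) (Q c) ⟩
  P a * (P (suc a) * Q c)      ∎)
  where open ≤-Reasoning

ratioNum ratioDen : ℕ → ℕ
ratioNum n = n ! * (3 * n + 1) !
ratioDen n = (n + n) ! * suc (n + n) !

ASMden-suc : ∀ k n → ASMden (suc k) n ≡ n ! * ASMden k (suc n)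
ASMden-suc zero    n = trans (*-identityˡ ((n + 0) !)) (trans (cong _! (+-identityʳ n)) (sym (*-identityʳ (n !))))
ASMden-suc (suc k) n = begin
  ASMden (suc k) n * (n + suc k) !         ≡⟨ cong₂ _*_ (ASMden-suc k n) (cong _! (+-suc n k)) ⟩
  n ! * ASMden k (suc n) * (suc n + k) !   ≡⟨ *-assoc (n !) _ _ ⟩
  n ! * ASMden (suc k) (suc n)             ∎
  where open ≡-Reasoning

ASMden-step : ∀ n → n ! * ASMden (suc n) (suc n) ≡ ASMden n n * ratioDen n
ASMden-step n = begin
  n ! * (ASMden n (suc n) * (suc n + n) !)   ≡⟨ *-assoc (n !) _ _ ⟨
  n ! * ASMden n (suc n) * (suc n + n) !     ≡⟨ cong (_* (suc n + n) !) (ASMden-suc n n) ⟨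
  ASMden n n * (n + n) ! * suc (n + n) !     ≡⟨ *-assoc (ASMden n n) _ _ ⟩
  ASMden n n * ratioDen n                    ∎
  where open ≡-Reasoning

A*ASMden≡ASMnum : ∀ n → A n * ASMden n n ≡ ASMnum n
A*ASMden≡ASMnum n = m/n*n≡m {{ASMden≢0 n n}} (ASMden∣ASMnum n)

A-ratio : ∀ n → A (suc n) * ratioDen n ≡ A n * ratioNum n
A-ratio n = *-cancelʳ-≡ _ _ (ASMden n n) {{ASMden≢0 n n}} (trans lhs (sym rhs))
  where
  open ≡-Reasoning
  lhs : A (suc n) * ratioDen n * ASMden n n ≡ n ! * ASMnum (suc n)
  lhs = begin
    A (suc n) * ratioDen n * ASMden n n        ≡⟨ *-assoc (A (suc n)) _ _ ⟩
    A (suc n) * (ratioDen n * ASMden n n)      ≡⟨ cong (A (suc n) *_) (trans (*-comm (ratioDen n) _) (sym (ASMden-step n))) ⟩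
    A (suc n) * (n ! * ASMden (suc n) (suc n)) ≡⟨ x∙yz≈y∙xz (A (suc n)) (n !) _ ⟩
    n ! * (A (suc n) * ASMden (suc n) (suc n)) ≡⟨ cong (n ! *_) (A*ASMden≡ASMnum (suc n)) ⟩
    n ! * ASMnum (suc n)                     ∎
  rhs : A n * ratioNum n * ASMden n n ≡ n ! * ASMnum (suc n)
  rhs = begin
    A n * ratioNum n * ASMden n n            ≡⟨ rearrange (A n) (n !) ((3 * n + 1) !) (ASMden n n) ⟩
    n ! * (A n * ASMden n n * (3 * n + 1) !) ≡⟨ cong (λ x → n ! * (x * (3 * n + 1) !)) (A*ASMden≡ASMnum n) ⟩
    n ! * ASMnum (suc n)                     ∎
    where
    rearrange : ∀ a f g d → a * (f * g) * d ≡ f * (a * d * g)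
    rearrange = solve-∀

numGrowth denGrowth : ℕ → ℕ
numGrowth n = (n + 1) * ((3 * n + 4) * ((3 * n + 3) * (3 * n + 2)))
denGrowth n = (2 * n + 2) * ((2 * n + 1) * ((2 * n + 3) * (2 * n + 2)))

denGrowth≤numGrowth : ∀ n → denGrowth n ≤ numGrowth n
denGrowth≤numGrowth n = subst (denGrowth n ≤_) (sym (difference n)) (m≤m+n (denGrowth n) _)
  where
  difference : ∀ n → (n + 1) * ((3 * n + 4) * ((3 * n + 3) * (3 * n + 2)))
                     ≡ (2 * n + 2) * ((2 * n + 1) * ((2 * n + 3) * (2 * n + 2)))
                       + (n + 1) * (n + 1) * (11 * n * n + 22 * n + 12)
  difference = solve-∀

ratioNum-suc : ∀ n → ratioNum (suc n) ≡ ratioNum n * numGrowth n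
ratioNum-suc n = trans (cong (λ x → suc n ! * x !) (eq n)) (unfold n (n !) ((3 * n + 1) !))
  where
  eq : ∀ n → 3 * suc n + 1 ≡ 3 + (3 * n + 1)
  eq = solve-∀
  unfold : ∀ n F G → suc n * F * (suc (suc (suc (3 * n + 1))) * (suc (suc (3 * n + 1)) * (suc (3 * n + 1) * G)))
                     ≡ F * G * ((n + 1) * ((3 * n + 4) * ((3 * n + 3) * (3 * n + 2))))
  unfold = solve-∀

ratioDen-suc : ∀ n → ratioDen (suc n) ≡ ratioDen n * denGrowth n
ratioDen-suc n = trans (cong (λ x → x ! * suc x !) (+-suc (suc n) n)) (unfold n ((n + n) !) (suc (n + n) !))
  where
  unfold : ∀ n F G → suc (suc (n + n)) * (suc (n + n) * F) * (suc (suc (suc (n + n))) * (suc (suc (n + n)) * G))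
                     ≡ F * G * ((2 * n + 2) * ((2 * n + 1) * ((2 * n + 3) * (2 * n + 2))))
  unfold = solve-∀

ratio-step : ∀ n → ratioNum n * ratioDen (suc n) ≤ ratioNum (suc n) * ratioDen n
ratio-step n = begin
  ratioNum n * ratioDen (suc n)               ≡⟨ cong (ratioNum n *_) (ratioDen-suc n) ⟩
  ratioNum n * (ratioDen n * denGrowth n)     ≤⟨ *-monoʳ-≤ (ratioNum n) (*-monoʳ-≤ (ratioDen n) (denGrowth≤numGrowth n)) ⟩
  ratioNum n * (ratioDen n * numGrowth n)     ≡⟨ x∙yz≈xz∙y (ratioNum n) (ratioDen n) (numGrowth n) ⟩
  ratioNum n * numGrowth n * ratioDen n       ≡⟨ cong (_* ratioDen n) (ratioNum-suc n) ⟨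
  ratioNum (suc n) * ratioDen n               ∎
  where open ≤-Reasoning

ratioNum≢0 : ∀ n → NonZero (ratioNum n)
ratioNum≢0 n = m*n≢0 (n !) ((3 * n + 1) !) {{n !≢0}} {{(3 * n + 1) !≢0}}

ratioDen≢0 : ∀ n → NonZero (ratioDen n)
ratioDen≢0 n = m*n≢0 ((n + n) !) (suc (n + n) !) {{(n + n) !≢0}} {{suc (n + n) !≢0}}

A-cross : ∀ x y → A x * A (suc y) * (ratioDen x * ratioDen y) ≡ A x * A y * (ratioNum y * ratioDen x)
A-cross x y = begin
  A x * A (suc y) * (ratioDen x * ratioDen y)   ≡⟨ regroup (A x) (A (suc y)) (ratioDen x) (ratioDen y) ⟩
  A x * (A (suc y) * ratioDen y) * ratioDen x   ≡⟨ cong (λ z → A x * z * ratioDen x) (A-ratio y) ⟩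
  A x * (A y * ratioNum y) * ratioDen x         ≡⟨ regroup′ (A x) (A y) (ratioNum y) (ratioDen x) ⟩
  A x * A y * (ratioNum y * ratioDen x)         ∎
  where
  open ≡-Reasoning
  regroup : ∀ a b d e → a * b * (d * e) ≡ a * (b * e) * d
  regroup = solve-∀
  regroup′ : ∀ a b r d → a * (b * r) * d ≡ a * b * (r * d)
  regroup′ = solve-∀

A-ratio-mono : ∀ {c a} → c ≤ a → A a * A (suc c) ≤ A (suc a) * A c
A-ratio-mono {c} {a} c≤a = *-cancelʳ-≤ _ _ (ratioDen a * ratioDen c) {{ratioDen²≢0}} (begin
  A a * A (suc c) * (ratioDen a * ratioDen c)   ≡⟨ A-cross a c ⟩
  A a * A c * (ratioNum c * ratioDen a)         ≤⟨ *-monoʳ-≤ (A a * A c) ratio≤ratio ⟩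
  A a * A c * (ratioNum a * ratioDen c)         ≡⟨ cong (_* (ratioNum a * ratioDen c)) (*-comm (A a) (A c)) ⟩
  A c * A a * (ratioNum a * ratioDen c)         ≡⟨ A-cross c a ⟨
  A c * A (suc a) * (ratioDen c * ratioDen a)   ≡⟨ cong₂ _*_ (*-comm (A c) (A (suc a))) (*-comm (ratioDen c) (ratioDen a)) ⟩
  A (suc a) * A c * (ratioDen a * ratioDen c)   ∎)
  where
  open ≤-Reasoning
  ratioDen²≢0 : NonZero (ratioDen a * ratioDen c)
  ratioDen²≢0 = m*n≢0 _ _ {{ratioDen≢0 a}} {{ratioDen≢0 c}}
  ratio≤ratio : ratioNum c * ratioDen a ≤ ratioNum a * ratioDen c
  ratio≤ratio = ratio-mono ratioNum ratioDen ratioNum≢0 ratio-step a c≤a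

lemma1 : (i₁ i₂ : ℕ) → 1 ≤ i₂ → i₂ ≤ i₁ →
    A i₁ * A i₂ ≤ A (suc i₁) * A (i₂ ∸ 1)
lemma1 i₁ (suc c) _ c<i₁ = A-ratio-mono (<⇒≤ c<i₁)
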